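{- Let $\mathbb{F}$ be a finite field, $G$ a subset of $\mathbb{F}$, $m,k\in\mathbb{N}$, and $d,d'\in\mathbb{N}$ with $d'\geq2(|G|-1)$. Let $\mathcal{P}$ denote the set of polynomials $Z\in\mathbb{F}[X_1,\dots,X_m,Y_1,\dots,Y_k]$ of individual degree at most $d$ in each $X_i$ and at most $d'$ in each $Y_j$. If $S\subseteq\mathbb{F}^{m+k}$ is such that there exist coefficients $(c_{\vec\alpha})_{\vec\alpha\in\mathbb{F}^m}$ and $(d_{\vec q})_{\vec q\in S}$ in $\mathbb{F}$ with (1) for all $Z\in\mathcal{P}$: $\sum_{\vec\alpha\in\mathbb{F}^m}c_{\vec\alpha}\sum_{\vec y\in G^k}Z(\vec\alpha,\vec y)=\sum_{\vec q\in S}d_{\vec q}Z(\vec q)$, and (2) there exists $Z'\in\mathcal{P}$ with $\sum_{\vec\alpha\in\mathbb{F}^m}c_{\vec\alpha}\sum_{\vec y\in G^k}Z'(\vec\alpha,\vec y)\neq0$, then $|S|\geq|G|^k$. -}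

module Defs where

open import Level using (Level; _⊔_)
open import Data.Nat using (ℕ; zero; suc)
open import Data.Fin using (Fin)
open import Data.Product using (∃; _×_)
open import Data.Vec.Functional using (_∷_)
open import Relation.Nullary using (¬_)
open import Relation.Binary.PropositionalEquality using (_≡_)
open import Algebra.Bundles using (CommutativeRing)

record FiniteField (c ℓ : Level) : Set (Level.suc (c ⊔ ℓ)) where
  field
    commutativeRing : CommutativeRing c ℓ
  open CommutativeRing commutativeRing public
  field
    1≉0     : ¬ (1# ≈ 0#)
    inverse : ∀ x → ¬ (x ≈ 0#) → ∃ λ y → (x * y) ≈ 1#
    size    : ℕ
    enum    : Fin size → Carrier
    enum-injective  : ∀ i j → enum i ≈ enum j → i ≡ j
    enum-surjective : ∀ x → ∃ λ i → enum i ≈ x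

module _ {c ℓ : Level} (F : FiniteField c ℓ) where
  open FiniteField F

  sumFin : (n : ℕ) → (Fin n → Carrier) → Carrier
  sumFin zero    f = 0#
  sumFin (suc n) f = f Fin.zero + sumFin n (λ i → f (Fin.suc i))

  sumTuples : (m q : ℕ) → ((Fin m → Fin q) → Carrier) → Carrier
  sumTuples zero    q f = f (λ ())
  sumTuples (suc m) q f = sumFin q (λ a → sumTuples m q (λ t → f (a ∷ t)))

  prodFin : (n : ℕ) → (Fin n → Carrier) → Carrier
  prodFin zero    f = 1#
  prodFin (suc n) f = f Fin.zero * prodFin n (λ i → f (Fin.suc i))

  pow : Carrier → ℕ → Carrier
  pow x zero    = 1#
  pow x (suc e) = x * pow x e

  sumFm : (m : ℕ) → ((Fin m → Carrier) → Carrier) → Carrier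
  sumFm m f = sumTuples m size (λ t → f (λ i → enum (t i)))

  -- Polynomials in X₁..X_m, Y₁..Y_k of individual degree ≤ d in each X_i
  -- and ≤ d' in each Y_j, given by their coefficients: a coefficient for each
  -- exponent vector (e , f) with e i ≤ d and f j ≤ d'.
  Poly : (m k d d' : ℕ) → Set c
  Poly m k d d' = (Fin m → Fin (suc d)) → (Fin k → Fin (suc d')) → Carrier

  eval : ∀ {m k d d'} → Poly m k d d' → (Fin m → Carrier) → (Fin k → Carrier) → Carrier
  eval {m} {k} {d} {d'} Z x y =
    sumTuples m (suc d) λ e → sumTuples k (suc d') λ f →
      (Z e f * prodFin m (λ i → pow (x i) (Data.Fin.toℕ (e i))))
             * prodFin k (λ j → pow (y j) (Data.Fin.toℕ (f j)))
    where import Data.Fin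

  lhsSum : ∀ {m k d d'} (g : ℕ) (gen : Fin g → Carrier)
           (coef : (Fin m → Carrier) → Carrier) → Poly m k d d' → Carrier
  lhsSum {m} {k} g gen coef Z =
    sumFm m λ α → coef α * sumTuples k g (λ t → eval Z α (λ j → gen (t j)))

  rhsSum : ∀ {m k d d'} (s : ℕ) (pts : Fin s → (Fin m → Carrier) × (Fin k → Carrier))
           (dq : Fin s → Carrier) → Poly m k d d' → Carrier
  rhsSum s pts dq Z =
    sumFin s λ i → dq i * eval Z (Data.Product.proj₁ (pts i)) (Data.Product.proj₂ (pts i))
    where import Data.Product

-- Expanding the left-hand side of (1) in monomials shows that (2) forces some
-- moment μ_e = Σ_α c_α α^e to be nonzero. If |S| < |G|^k, the |S| linear conditions
-- "u vanishes at the Y-part of every point of S" on u = Σ_z v_z L_z, with L_z the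
-- Lagrange indicator of z ∈ G^k, have a solution with some v_{z₀} ≠ 0. The polynomial
-- X^e · u(Y) · L_{z₀}(Y) lies in 𝒫 because d' ≥ 2(|G|-1), and its right-hand side in (1)
-- vanishes; but since u = v_z on G^k, its left-hand side is μ_e · v_{z₀} ≠ 0.
module Submission where

open import Defs
open import Level using (Level)
open import Data.Empty using (⊥-elim)
open import Data.Nat as ℕ using (ℕ; zero; suc)
import Data.Nat.Properties as ℕₚ
open import Data.Fin
  using (Fin; zero; suc; toℕ; fromℕ<; punchIn; punchOut; _≟_; finToFun; funToFin; combine)
import Data.Fin.Properties as Finₚ
open import Data.Product using (_×_; ∃; proj₁; proj₂; _,_)
open import Data.Vec.Functional using (_∷_)
open import Function using (_∘_; flip)
open import Relation.Nullary using (¬_; yes; no)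
open import Relation.Binary.Definitions using (Decidable)
open import Relation.Binary.PropositionalEquality as ≡ using (_≡_; _≢_)
import Relation.Binary.Reasoning.Setoid as SetoidReasoning
import Algebra.Properties.CommutativeMonoid.Sum as CommutativeMonoidSum
import Algebra.Properties.CommutativeSemigroup as CommutativeSemigroupProperties
import Algebra.Properties.Ring as RingProperties
import Algebra.Properties.Semiring.Exp as SemiringExp
import Algebra.Properties.Semiring.Sum as SemiringSum

exponent-sum-bound : ∀ {g d′} → 2 ℕ.* (g ℕ.∸ 1) ℕ.≤ d′ →
                     (a b : Fin g) → toℕ a ℕ.+ toℕ b ℕ.< suc d′
exponent-sum-bound {suc g} 2g≤d′ a b = ℕ.s≤s (ℕₚ.≤-trans
  (ℕₚ.+-mono-≤ (Finₚ.toℕ≤pred[n] a) (Finₚ.toℕ≤pred[n] b))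
  (ℕₚ.≤-trans (ℕₚ.≤-reflexive (≡.cong (g ℕ.+_) (≡.sym (ℕₚ.+-identityʳ g)))) 2g≤d′))

module _ {c ℓ : Level} (F : FiniteField c ℓ) where
  open FiniteField F hiding (zero)
  open SetoidReasoning setoid
  open CommutativeSemigroupProperties *-commutativeSemigroup
    using (interchange; xy∙z≈xz∙y; xy∙z≈y∙xz; x∙yz≈y∙xz)
  open CommutativeSemigroupProperties +-commutativeSemigroup
    using () renaming (x∙yz≈yx∙z to x+[y+z]≈[y+x]+z)
  open RingProperties ring
    using (-‿distribˡ-*; -‿distribʳ-*; x∙y⁻¹≈ε⇒x≈y)
  private
    module Exp = SemiringExp semiring
    module Σ = SemiringSum semiring
    module Π = CommutativeMonoidSum *-commutativeMonoid
      using () renaming (sum to product; sum-cong-≋ to product-cong;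
                         ∑-distrib-+ to product-distrib-*; sum-replicate-zero to product-replicate-one)

  -- Finite sums and products

  ∑ : (n : ℕ) → (Fin n → Carrier) → Carrier
  ∑ = sumFin F

  ∏ : (n : ℕ) → (Fin n → Carrier) → Carrier
  ∏ = prodFin F

  ∑ₜ : (n q : ℕ) → ((Fin n → Fin q) → Carrier) → Carrier
  ∑ₜ = sumTuples F

  sumFin≡sum : ∀ n (f : Fin n → Carrier) → ∑ n f ≡ Σ.sum f
  sumFin≡sum zero    f = ≡.refl
  sumFin≡sum (suc n) f = ≡.cong (f zero +_) (sumFin≡sum n (f ∘ suc))

  prodFin≡product : ∀ n (f : Fin n → Carrier) → ∏ n f ≡ Π.product f
  prodFin≡product zero    f = ≡.refl
  prodFin≡product (suc n) f = ≡.cong (f zero *_) (prodFin≡product n (f ∘ suc))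

  ∑-cong : ∀ n {f g : Fin n → Carrier} → (∀ i → f i ≈ g i) → ∑ n f ≈ ∑ n g
  ∑-cong n {f} {g} f≈g rewrite sumFin≡sum n f | sumFin≡sum n g = Σ.sum-cong-≋ f≈g

  ∑-zero : ∀ n {f : Fin n → Carrier} → (∀ i → f i ≈ 0#) → ∑ n f ≈ 0#
  ∑-zero n f≈0 =
    trans (∑-cong n f≈0) (trans (reflexive (sumFin≡sum n _)) (Σ.sum-replicate-zero n))

  ∑-distrib-+ : ∀ n (f g : Fin n → Carrier) → ∑ n (λ i → f i + g i) ≈ ∑ n f + ∑ n g
  ∑-distrib-+ n f g
    rewrite sumFin≡sum n (λ i → f i + g i) | sumFin≡sum n f | sumFin≡sum n g =
    Σ.∑-distrib-+ f g

  *-distribˡ-∑ : ∀ n x (f : Fin n → Carrier) → x * ∑ n f ≈ ∑ n (λ i → x * f i)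
  *-distribˡ-∑ n x f rewrite sumFin≡sum n f | sumFin≡sum n (λ i → x * f i) =
    Σ.*-distribˡ-sum x f

  *-distribʳ-∑ : ∀ n x (f : Fin n → Carrier) → ∑ n f * x ≈ ∑ n (λ i → f i * x)
  *-distribʳ-∑ n x f rewrite sumFin≡sum n f | sumFin≡sum n (λ i → f i * x) =
    Σ.*-distribʳ-sum x f

  ∑-comm : ∀ a b (h : Fin a → Fin b → Carrier) →
           ∑ a (λ i → ∑ b (h i)) ≈ ∑ b (λ j → ∑ a (λ i → h i j))
  ∑-comm a b h = begin
    ∑ a (λ i → ∑ b (h i))              ≡⟨ sumFin²≡sum² a b h ⟩
    Σ.sum (λ i → Σ.sum (h i))          ≈⟨ Σ.∑-comm h ⟩
    Σ.sum (λ j → Σ.sum (λ i → h i j))  ≡⟨ sumFin²≡sum² b a (flip h) ⟨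
    ∑ b (λ j → ∑ a (λ i → h i j))      ∎
    where
    sumFin²≡sum² : ∀ a b (h : Fin a → Fin b → Carrier) →
                   ∑ a (λ i → ∑ b (h i)) ≡ Σ.sum (λ i → Σ.sum (h i))
    sumFin²≡sum² a b h =
      ≡.trans (sumFin≡sum a _) (Σ.sum-cong-≗ (λ i → sumFin≡sum b (h i)))

  ∏-cong : ∀ n {f g : Fin n → Carrier} → (∀ i → f i ≈ g i) → ∏ n f ≈ ∏ n g
  ∏-cong n {f} {g} f≈g rewrite prodFin≡product n f | prodFin≡product n g =
    Π.product-cong f≈g

  ∏-one : ∀ n {f : Fin n → Carrier} → (∀ i → f i ≈ 1#) → ∏ n f ≈ 1#
  ∏-one n f≈1 =
    trans (∏-cong n f≈1) (trans (reflexive (prodFin≡product n _)) (Π.product-replicate-one n))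

  ∏-distrib-* : ∀ n (f g : Fin n → Carrier) → ∏ n (λ i → f i * g i) ≈ ∏ n f * ∏ n g
  ∏-distrib-* n f g
    rewrite prodFin≡product n (λ i → f i * g i) | prodFin≡product n f | prodFin≡product n g =
    Π.product-distrib-* f g

  ∏-zero : ∀ n (f : Fin n → Carrier) j → f j ≈ 0# → ∏ n f ≈ 0#
  ∏-zero (suc n) f zero    fj≈0 = trans (*-cong fj≈0 refl) (zeroˡ _)
  ∏-zero (suc n) f (suc j) fj≈0 = trans (*-cong refl (∏-zero n (f ∘ suc) j fj≈0)) (zeroʳ _)

  _≈?_ : Decidable _≈_
  x ≈? y with enum-surjective x | enum-surjective y
  ... | i , eᵢ≈x | j , eⱼ≈y with i ≟ j
  ...   | yes ≡.refl = yes (trans (sym eᵢ≈x) eⱼ≈y)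
  ...   | no  i≢j    = no (λ x≈y → i≢j (enum-injective i j (trans eᵢ≈x (trans x≈y (sym eⱼ≈y)))))

  *-≉0 : ∀ {x y} → x ≉ 0# → y ≉ 0# → x * y ≉ 0#
  *-≉0 {x} {y} x≉0 y≉0 xy≈0 = y≉0 (begin
    y              ≈⟨ *-identityˡ y ⟨
    1# * y         ≈⟨ *-cong x⁻¹x≈1 refl ⟨
    (x⁻¹ * x) * y  ≈⟨ *-assoc x⁻¹ x y ⟩
    x⁻¹ * (x * y)  ≈⟨ *-cong refl xy≈0 ⟩
    x⁻¹ * 0#       ≈⟨ zeroʳ x⁻¹ ⟩
    0#             ∎)
    where
    x⁻¹ : Carrier
    x⁻¹ = proj₁ (inverse x x≉0)
    x⁻¹x≈1 : x⁻¹ * x ≈ 1#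
    x⁻¹x≈1 = trans (*-comm x⁻¹ x) (proj₂ (inverse x x≉0))

  ∏-≉0 : ∀ n (f : Fin n → Carrier) → (∀ i → f i ≉ 0#) → ∏ n f ≉ 0#
  ∏-≉0 zero    f f≉0 = 1≉0
  ∏-≉0 (suc n) f f≉0 = *-≉0 (f≉0 zero) (∏-≉0 n (f ∘ suc) (f≉0 ∘ suc))

  ∑-nonzero-term : ∀ n (f : Fin n → Carrier) → ∑ n f ≉ 0# → ∃ λ i → f i ≉ 0#
  ∑-nonzero-term zero    f ∑≉0 = ⊥-elim (∑≉0 refl)
  ∑-nonzero-term (suc n) f ∑≉0 with f zero ≈? 0#
  ... | no  f₀≉0 = zero , f₀≉0
  ... | yes f₀≈0 =
    let i , fᵢ≉0 = ∑-nonzero-term n (f ∘ suc)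
                     (λ rest≈0 → ∑≉0 (trans (+-cong f₀≈0 rest≈0) (+-identityˡ 0#)))
    in suc i , fᵢ≉0

  δ : ∀ {n} → Fin n → Fin n → Carrier
  δ zero    zero    = 1#
  δ zero    (suc _) = 0#
  δ (suc _) zero    = 0#
  δ (suc a) (suc b) = δ a b

  δ-refl : ∀ {n} (a : Fin n) → δ a a ≈ 1#
  δ-refl zero    = refl
  δ-refl (suc a) = δ-refl a

  δ-≢ : ∀ {n} {a b : Fin n} → a ≢ b → δ a b ≈ 0#
  δ-≢ {a = zero}  {zero}  a≢b = ⊥-elim (a≢b ≡.refl)
  δ-≢ {a = zero}  {suc b} a≢b = refl
  δ-≢ {a = suc a} {zero}  a≢b = refl
  δ-≢ {a = suc a} {suc b} a≢b = δ-≢ (a≢b ∘ ≡.cong suc)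

  ∑-δ : ∀ n (a : Fin n) (h : Fin n → Carrier) → ∑ n (λ b → δ a b * h b) ≈ h a
  ∑-δ (suc n) zero    h =
    trans (+-cong (*-identityˡ _) (∑-zero n (λ _ → zeroˡ _))) (+-identityʳ _)
  ∑-δ (suc n) (suc a) h =
    trans (+-cong (zeroˡ _) (∑-δ n a (h ∘ suc))) (+-identityˡ _)

  ∑ₜ-cong : ∀ n q {f g : (Fin n → Fin q) → Carrier} → (∀ t → f t ≈ g t) → ∑ₜ n q f ≈ ∑ₜ n q g
  ∑ₜ-cong zero    q f≈g = f≈g _
  ∑ₜ-cong (suc n) q f≈g = ∑-cong q (λ a → ∑ₜ-cong n q (λ t → f≈g (a ∷ t)))

  *-distribˡ-∑ₜ : ∀ n q x (f : (Fin n → Fin q) → Carrier) →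
                  x * ∑ₜ n q f ≈ ∑ₜ n q (λ t → x * f t)
  *-distribˡ-∑ₜ zero    q x f = refl
  *-distribˡ-∑ₜ (suc n) q x f =
    trans (*-distribˡ-∑ q x _) (∑-cong q (λ a → *-distribˡ-∑ₜ n q x (λ t → f (a ∷ t))))

  *-distribʳ-∑ₜ : ∀ n q x (f : (Fin n → Fin q) → Carrier) →
                  ∑ₜ n q f * x ≈ ∑ₜ n q (λ t → f t * x)
  *-distribʳ-∑ₜ zero    q x f = refl
  *-distribʳ-∑ₜ (suc n) q x f =
    trans (*-distribʳ-∑ q x _) (∑-cong q (λ a → *-distribʳ-∑ₜ n q x (λ t → f (a ∷ t))))

  ∑ₜ-comm-∑ : ∀ n q r (h : (Fin n → Fin q) → Fin r → Carrier) →
              ∑ₜ n q (λ t → ∑ r (h t)) ≈ ∑ r (λ i → ∑ₜ n q (λ t → h t i))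
  ∑ₜ-comm-∑ zero    q r h = refl
  ∑ₜ-comm-∑ (suc n) q r h =
    trans (∑-cong q (λ a → ∑ₜ-comm-∑ n q r (λ t → h (a ∷ t))))
          (∑-comm q r (λ a i → ∑ₜ n q (λ t → h (a ∷ t) i)))

  ∑ₜ-comm : ∀ n q n′ q′ (h : (Fin n → Fin q) → (Fin n′ → Fin q′) → Carrier) →
            ∑ₜ n q (λ t → ∑ₜ n′ q′ (h t)) ≈ ∑ₜ n′ q′ (λ u → ∑ₜ n q (λ t → h t u))
  ∑ₜ-comm zero    q n′ q′ h = refl
  ∑ₜ-comm (suc n) q n′ q′ h =
    trans (∑-cong q (λ a → ∑ₜ-comm n q n′ q′ (λ t → h (a ∷ t))))
          (sym (∑ₜ-comm-∑ n′ q′ q (λ u a → ∑ₜ n q (λ t → h (a ∷ t) u))))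

  ∑ₜ-nonzero-term : ∀ n q (f : (Fin n → Fin q) → Carrier) → ∑ₜ n q f ≉ 0# →
                    ∃ λ t → f t ≉ 0#
  ∑ₜ-nonzero-term zero    q f ∑≉0 = _ , ∑≉0
  ∑ₜ-nonzero-term (suc n) q f ∑≉0 =
    let a , ∑ₐ≉0 = ∑-nonzero-term q _ ∑≉0
        t , fₜ≉0 = ∑ₜ-nonzero-term n q (λ t → f (a ∷ t)) ∑ₐ≉0
    in a ∷ t , fₜ≉0

  ∑ₜ-∏ : ∀ n q (h : Fin n → Fin q → Carrier) →
         ∑ₜ n q (λ t → ∏ n (λ i → h i (t i))) ≈ ∏ n (λ i → ∑ q (h i))
  ∑ₜ-∏ zero    q h = refl
  ∑ₜ-∏ (suc n) q h = begin
    ∑ q (λ a → ∑ₜ n q (λ t → h zero a * ∏ n (λ i → h (suc i) (t i))))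
      ≈⟨ ∑-cong q (λ a → *-distribˡ-∑ₜ n q (h zero a) _) ⟨
    ∑ q (λ a → h zero a * ∑ₜ n q (λ t → ∏ n (λ i → h (suc i) (t i))))
      ≈⟨ ∑-cong q (λ a → *-cong refl (∑ₜ-∏ n q (h ∘ suc))) ⟩
    ∑ q (λ a → h zero a * ∏ n (λ i → ∑ q (h (suc i))))
      ≈⟨ *-distribʳ-∑ q _ (h zero) ⟨
    ∑ q (h zero) * ∏ n (λ i → ∑ q (h (suc i)))
      ∎

  -- Polynomials as coefficient families

  pow≡^ : ∀ x n → pow F x n ≡ x Exp.^ n
  pow≡^ x zero    = ≡.refl
  pow≡^ x (suc n) = ≡.cong (x *_) (pow≡^ x n)

  pow-+ : ∀ x a b → pow F x (a ℕ.+ b) ≈ pow F x a * pow F x b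
  pow-+ x a b rewrite pow≡^ x (a ℕ.+ b) | pow≡^ x a | pow≡^ x b = Exp.^-homo-* x a b

  monomial : ∀ {n q} → (Fin n → Carrier) → (Fin n → Fin q) → Carrier
  monomial {n} x e = ∏ n (λ i → pow F (x i) (toℕ (e i)))

  monomial-+ : ∀ {n q q₁ q₂} (x : Fin n → Carrier)
               (e : Fin n → Fin q) (e₁ : Fin n → Fin q₁) (e₂ : Fin n → Fin q₂) →
               (∀ i → toℕ (e i) ≡ toℕ (e₁ i) ℕ.+ toℕ (e₂ i)) →
               monomial x e ≈ monomial x e₁ * monomial x e₂
  monomial-+ {n} x e e₁ e₂ e≡e₁+e₂ =
    trans (∏-cong n (λ i → trans (reflexive (≡.cong (pow F (x i)) (e≡e₁+e₂ i)))
                                 (pow-+ (x i) (toℕ (e₁ i)) (toℕ (e₂ i)))))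
          (∏-distrib-* n _ _)

  ⟦_⟧ : ∀ {n q} → ((Fin n → Fin q) → Carrier) → (Fin n → Carrier) → Carrier
  ⟦_⟧ {n} {q} p x = ∑ₜ n q (λ e → p e * monomial x e)

  ⟦⟧-cong : ∀ {n q} {p p′ : (Fin n → Fin q) → Carrier} → (∀ e → p e ≈ p′ e) →
            ∀ x → ⟦ p ⟧ x ≈ ⟦ p′ ⟧ x
  ⟦⟧-cong {n} {q} p≈p′ x = ∑ₜ-cong n q (λ e → *-cong (p≈p′ e) refl)

  ⟦⟧-*ˡ : ∀ {n q} a (p : (Fin n → Fin q) → Carrier) x →
          ⟦ (λ e → a * p e) ⟧ x ≈ a * ⟦ p ⟧ x
  ⟦⟧-*ˡ {n} {q} a p x =
    trans (∑ₜ-cong n q (λ e → *-assoc a (p e) _)) (sym (*-distribˡ-∑ₜ n q a _))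

  ⟦⟧-*ʳ : ∀ {n q} (p : (Fin n → Fin q) → Carrier) a x →
          ⟦ (λ e → p e * a) ⟧ x ≈ ⟦ p ⟧ x * a
  ⟦⟧-*ʳ {n} {q} p a x =
    trans (∑ₜ-cong n q (λ e → xy∙z≈xz∙y (p e) a _)) (sym (*-distribʳ-∑ₜ n q a _))

  ⟦⟧-∑ : ∀ {n q} r (p : Fin r → (Fin n → Fin q) → Carrier) x →
         ⟦ (λ e → ∑ r (λ i → p i e)) ⟧ x ≈ ∑ r (λ i → ⟦ p i ⟧ x)
  ⟦⟧-∑ {n} {q} r p x =
    trans (∑ₜ-cong n q (λ e → *-distribʳ-∑ r (monomial x e) (λ i → p i e)))
          (∑ₜ-comm-∑ n q r (λ e i → p i e * monomial x e))

  ⟦⟧-∑ₜ : ∀ {n q} r s (p : (Fin r → Fin s) → (Fin n → Fin q) → Carrier) x →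
          ⟦ (λ e → ∑ₜ r s (λ t → p t e)) ⟧ x ≈ ∑ₜ r s (λ t → ⟦ p t ⟧ x)
  ⟦⟧-∑ₜ {n} {q} r s p x =
    trans (∑ₜ-cong n q (λ e → *-distribʳ-∑ₜ r s (monomial x e) (λ t → p t e)))
          (∑ₜ-comm n q r s (λ e t → p t e * monomial x e))

  ⟦⟧-∏ : ∀ {n q} (p : Fin n → Fin q → Carrier) x →
         ⟦ (λ e → ∏ n (λ i → p i (e i))) ⟧ x ≈
         ∏ n (λ i → ∑ q (λ a → p i a * pow F (x i) (toℕ a)))
  ⟦⟧-∏ {n} {q} p x =
    trans (∑ₜ-cong n q (λ e → sym (∏-distrib-* n (λ i → p i (e i)) _)))
          (∑ₜ-∏ n q (λ i a → p i a * pow F (x i) (toℕ a)))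

  Δ : ∀ {n q} → (Fin n → Fin q) → (Fin n → Fin q) → Carrier
  Δ {n} a b = ∏ n (λ i → δ (a i) (b i))

  ⟦Δ⟧ : ∀ {n q} (a : Fin n → Fin q) x → ⟦ Δ a ⟧ x ≈ monomial x a
  ⟦Δ⟧ {n} {q} a x =
    trans (⟦⟧-∏ (λ i → δ (a i)) x)
          (∏-cong n (λ i → ∑-δ q (a i) (λ b → pow F (x i) (toℕ b))))

  Δ-refl : ∀ {n q} (a : Fin n → Fin q) → Δ a a ≈ 1#
  Δ-refl {n} a = ∏-one n (λ i → δ-refl (a i))

  Δ-≢ : ∀ {n q} {a b : Fin n → Fin q} j → a j ≢ b j → Δ a b ≈ 0#
  Δ-≢ {n} j aⱼ≢bⱼ = ∏-zero n _ j (δ-≢ aⱼ≢bⱼ)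

  ∑ₜ-Δ*Δ : ∀ n q (a b : Fin n → Fin q) → ∑ₜ n q (λ t → Δ a t * Δ b t) ≈ Δ b a
  ∑ₜ-Δ*Δ n q a b =
    trans (∑ₜ-cong n q (λ t → sym (∏-distrib-* n (λ i → δ (a i) (t i)) (λ i → δ (b i) (t i)))))
          (trans (∑ₜ-∏ n q (λ i c → δ (a i) c * δ (b i) c))
                 (∏-cong n (λ i → ∑-δ q (a i) (δ (b i)))))

  funToFin-cong : ∀ {n q} {f h : Fin n → Fin q} → (∀ i → f i ≡ h i) → funToFin f ≡ funToFin h
  funToFin-cong {zero}  f≗h = ≡.refl
  funToFin-cong {suc n} f≗h = ≡.cong₂ combine (f≗h zero) (funToFin-cong (f≗h ∘ suc))

  Δ-finToFun : ∀ {n q} (i i′ : Fin (q ℕ.^ n)) → Δ (finToFun {q} {n} i) (finToFun i′) ≈ δ i i′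
  Δ-finToFun {n} {q} i i′ with i ≟ i′
  ... | yes ≡.refl = trans (Δ-refl {n} (finToFun i)) (sym (δ-refl i))
  ... | no  i≢i′ =
    let j , differ = Finₚ.¬∀⟶∃¬ n _ (λ j → finToFun i j ≟ finToFun i′ j) (i≢i′ ∘ finToFun-injective)
    in trans (Δ-≢ {a = finToFun i} {finToFun i′} j differ) (sym (δ-≢ i≢i′))
    where
    finToFun-injective : (∀ j → finToFun {q} {n} i j ≡ finToFun i′ j) → i ≡ i′
    finToFun-injective same = ≡.trans (≡.sym (Finₚ.funToFin-finToFin {n} i))
      (≡.trans (funToFin-cong same) (Finₚ.funToFin-finToFin {n} i′))

  eval-iterated : ∀ {m k d d′} (Z : Poly F m k d d′) x y →
                  eval F Z x y ≈ ⟦ (λ e → ⟦ Z e ⟧ y) ⟧ x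
  eval-iterated {m} {k} {d} {d′} Z x y = ∑ₜ-cong m (suc d) λ e →
    trans (∑ₜ-cong k (suc d′) (λ f → xy∙z≈xz∙y (Z e f) (monomial x e) (monomial y f)))
          (sym (*-distribʳ-∑ₜ k (suc d′) (monomial x e) _))

  module Convolution {q₁ q₂ q : ℕ}
    (fits : ∀ (a : Fin q₁) (b : Fin q₂) → toℕ a ℕ.+ toℕ b ℕ.< q) where

    _⊕_ : ∀ {k} → (Fin k → Fin q₁) → (Fin k → Fin q₂) → Fin k → Fin q
    (f ⊕ h) j = fromℕ< (fits (f j) (h j))

    _⋆_ : ∀ {k} → ((Fin k → Fin q₁) → Carrier) → ((Fin k → Fin q₂) → Carrier) →
          (Fin k → Fin q) → Carrier
    _⋆_ {k} u w E = ∑ₜ k q₁ (λ f → ∑ₜ k q₂ (λ h → (u f * w h) * Δ (f ⊕ h) E))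

    ⟦⋆⟧ : ∀ {k} (u : (Fin k → Fin q₁) → Carrier) (w : (Fin k → Fin q₂) → Carrier) y →
          ⟦ u ⋆ w ⟧ y ≈ ⟦ u ⟧ y * ⟦ w ⟧ y
    ⟦⋆⟧ {k} u w y = begin
      ⟦ u ⋆ w ⟧ y
        ≈⟨ ⟦⟧-∑ₜ k q₁ _ y ⟩
      ∑ₜ k q₁ (λ f → ⟦ (λ E → ∑ₜ k q₂ (λ h → (u f * w h) * Δ (f ⊕ h) E)) ⟧ y)
        ≈⟨ ∑ₜ-cong k q₁ (λ f → ⟦⟧-∑ₜ k q₂ _ y) ⟩
      ∑ₜ k q₁ (λ f → ∑ₜ k q₂ (λ h → ⟦ (λ E → (u f * w h) * Δ (f ⊕ h) E) ⟧ y))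
        ≈⟨ ∑ₜ-cong k q₁ (λ f → ∑ₜ-cong k q₂ (λ h → ⟦u⋆w⟧-term f h)) ⟩
      ∑ₜ k q₁ (λ f → ∑ₜ k q₂ (λ h → (u f * monomial y f) * (w h * monomial y h)))
        ≈⟨ ∑ₜ-cong k q₁ (λ f → *-distribˡ-∑ₜ k q₂ _ _) ⟨
      ∑ₜ k q₁ (λ f → (u f * monomial y f) * ⟦ w ⟧ y)
        ≈⟨ *-distribʳ-∑ₜ k q₁ _ _ ⟨
      ⟦ u ⟧ y * ⟦ w ⟧ y ∎
      where
      ⟦u⋆w⟧-term : ∀ f h → ⟦ (λ E → (u f * w h) * Δ (f ⊕ h) E) ⟧ y ≈
                             (u f * monomial y f) * (w h * monomial y h)
      ⟦u⋆w⟧-term f h = begin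
        ⟦ (λ E → (u f * w h) * Δ (f ⊕ h) E) ⟧ y     ≈⟨ ⟦⟧-*ˡ _ (Δ (f ⊕ h)) y ⟩
        (u f * w h) * ⟦ Δ (f ⊕ h) ⟧ y               ≈⟨ *-cong refl (⟦Δ⟧ (f ⊕ h) y) ⟩
        (u f * w h) * monomial y (f ⊕ h)            ≈⟨ *-cong refl (monomial-+ y (f ⊕ h) f h
                                                         (λ j → Finₚ.toℕ-fromℕ< _)) ⟩
        (u f * w h) * (monomial y f * monomial y h) ≈⟨ interchange _ _ _ _ ⟩
        (u f * monomial y f) * (w h * monomial y h) ∎

  -- Lagrange interpolation

  horner : ∀ {n} → (Fin n → Carrier) → Carrier → Carrier
  horner {zero}  p u = 0#
  horner {suc n} p u = p zero + u * horner (p ∘ suc) u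

  horner≈∑ : ∀ n (p : Fin n → Carrier) u → horner p u ≈ ∑ n (λ i → p i * pow F u (toℕ i))
  horner≈∑ zero    p u = refl
  horner≈∑ (suc n) p u = +-cong (sym (*-identityʳ _)) (begin
    u * horner (p ∘ suc) u
      ≈⟨ *-cong refl (horner≈∑ n (p ∘ suc) u) ⟩
    u * ∑ n (λ i → p (suc i) * pow F u (toℕ i))
      ≈⟨ *-distribˡ-∑ n u _ ⟩
    ∑ n (λ i → u * (p (suc i) * pow F u (toℕ i)))
      ≈⟨ ∑-cong n (λ i → x∙yz≈y∙xz u (p (suc i)) _) ⟩
    ∑ n (λ i → p (suc i) * (u * pow F u (toℕ i))) ∎)

  -- (X - b) · (p₀ + X p′) = - b p₀ + X (p₀ + (X - b) p′)
  timesLinear : ∀ {n} → Carrier → (Fin n → Carrier) → Fin (suc n) → Carrier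
  timesLinear {zero}  b p = λ _ → 0#
  timesLinear {suc n} b p = - (b * p zero) ∷ (p zero + r zero) ∷ (r ∘ suc)
    where
    r : Fin (suc n) → Carrier
    r = timesLinear b (p ∘ suc)

  horner-timesLinear : ∀ n b (p : Fin n → Carrier) u →
                       horner (timesLinear b p) u ≈ (u - b) * horner p u
  horner-timesLinear zero b p u =
    trans (+-identityˡ _) (trans (zeroʳ u) (sym (zeroʳ _)))
  horner-timesLinear (suc n) b p u = begin
    - (b * p₀) + u * ((p₀ + r zero) + u * horner (r ∘ suc) u)
      ≈⟨ +-cong refl (*-cong refl (+-assoc _ _ _)) ⟩
    - (b * p₀) + u * (p₀ + horner r u)
      ≈⟨ +-cong refl (*-cong refl (+-cong refl (horner-timesLinear n b (p ∘ suc) u))) ⟩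
    - (b * p₀) + u * (p₀ + (u - b) * E)
      ≈⟨ +-cong refl (distribˡ u _ _) ⟩
    - (b * p₀) + (u * p₀ + u * ((u - b) * E))
      ≈⟨ x+[y+z]≈[y+x]+z _ _ _ ⟩
    (u * p₀ + - (b * p₀)) + u * ((u - b) * E)
      ≈⟨ +-cong (+-cong refl (-‿distribˡ-* b p₀)) (x∙yz≈y∙xz u (u - b) E) ⟩
    (u * p₀ + - b * p₀) + (u - b) * (u * E)
      ≈⟨ +-cong (distribʳ p₀ u (- b)) refl ⟨
    (u - b) * p₀ + (u - b) * (u * E)
      ≈⟨ distribˡ _ _ _ ⟨
    (u - b) * (p₀ + u * E) ∎
    where
    p₀ E : Carrier
    p₀ = p zero
    E  = horner (p ∘ suc) u
    r : Fin (suc n) → Carrier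
    r = timesLinear b (p ∘ suc)

  fromRoots : ∀ {n} → (Fin n → Carrier) → Fin (suc n) → Carrier
  fromRoots {zero}  bs = λ _ → 1#
  fromRoots {suc n} bs = timesLinear (bs zero) (fromRoots (bs ∘ suc))

  horner-fromRoots : ∀ n (bs : Fin n → Carrier) u →
                     horner (fromRoots bs) u ≈ ∏ n (λ j → u - bs j)
  horner-fromRoots zero    bs u = trans (+-cong refl (zeroʳ u)) (+-identityʳ 1#)
  horner-fromRoots (suc n) bs u =
    trans (horner-timesLinear (suc n) (bs zero) (fromRoots (bs ∘ suc)) u)
          (*-cong refl (horner-fromRoots n (bs ∘ suc) u))

  denominator≉0 : ∀ {g′} (gen : Fin (suc g′) → Carrier) → (∀ i j → gen i ≈ gen j → i ≡ j) →
                  ∀ a → ∏ g′ (λ j → gen a - gen (punchIn a j)) ≉ 0#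
  denominator≉0 {g′} gen gen-injective a = ∏-≉0 g′ _ λ j a-j≈0 →
    Finₚ.punchInᵢ≢i a j (≡.sym (gen-injective _ _ (x∙y⁻¹≈ε⇒x≈y _ _ a-j≈0)))

  -- Coefficients of ∏_{j ≠ a} (X - gen j) / (gen a - gen j).
  lagrange : ∀ {g} (gen : Fin g → Carrier) → (∀ i j → gen i ≈ gen j → i ≡ j) →
             Fin g → Fin g → Carrier
  lagrange {suc g′} gen gen-injective a i =
    fromRoots (λ j → gen (punchIn a j)) i * proj₁ (inverse _ (denominator≉0 gen gen-injective a))

  lagrange-δ : ∀ {g} (gen : Fin g → Carrier) (gen-injective : ∀ i j → gen i ≈ gen j → i ≡ j) a b →
               ∑ g (λ i → lagrange gen gen-injective a i * pow F (gen b) (toℕ i)) ≈ δ a b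
  lagrange-δ {suc g′} gen gen-injective a b = begin
    ∑ (suc g′) (λ i → (R i * κ) * pow F u (toℕ i))
      ≈⟨ ∑-cong (suc g′) (λ i → xy∙z≈y∙xz (R i) κ (pow F u (toℕ i))) ⟩
    ∑ (suc g′) (λ i → κ * (R i * pow F u (toℕ i)))
      ≈⟨ *-distribˡ-∑ (suc g′) κ (λ i → R i * pow F u (toℕ i)) ⟨
    κ * ∑ (suc g′) (λ i → R i * pow F u (toℕ i))
      ≈⟨ *-cong refl (horner≈∑ (suc g′) R u) ⟨
    κ * horner R u
      ≈⟨ *-cong refl (horner-fromRoots g′ _ u) ⟩
    κ * ∏ g′ (λ j → u - gen (punchIn a j))
      ≈⟨ κ*values≈δ ⟩
    δ a b ∎
    where
    R : Fin (suc g′) → Carrier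
    R = fromRoots (λ j → gen (punchIn a j))
    D≉0 : ∏ g′ (λ j → gen a - gen (punchIn a j)) ≉ 0#
    D≉0 = denominator≉0 gen gen-injective a
    κ : Carrier
    κ = proj₁ (inverse _ D≉0)
    u : Carrier
    u = gen b
    κ*values≈δ : κ * ∏ g′ (λ j → u - gen (punchIn a j)) ≈ δ a b
    κ*values≈δ with a ≟ b
    ... | yes ≡.refl = trans (*-comm _ _) (trans (proj₂ (inverse _ D≉0)) (sym (δ-refl a)))
    ... | no  a≢b    = trans (*-cong refl (∏-zero g′ _ (punchOut a≢b) u-u≈0))
                             (trans (zeroʳ κ) (sym (δ-≢ a≢b)))
      where
      u-u≈0 : u - gen (punchIn a (punchOut a≢b)) ≈ 0#
      u-u≈0 = trans (+-cong refl (-‿cong (reflexive (≡.cong gen (Finₚ.punchIn-punchOut a≢b)))))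
                    (-‿inverseʳ u)

  lagrangeₜ : ∀ {n g} (gen : Fin g → Carrier) → (∀ i j → gen i ≈ gen j → i ≡ j) →
              (Fin n → Fin g) → (Fin n → Fin g) → Carrier
  lagrangeₜ {n} gen gen-injective z f = ∏ n (λ j → lagrange gen gen-injective (z j) (f j))

  ⟦lagrangeₜ⟧ : ∀ {n g} (gen : Fin g → Carrier) (gen-injective : ∀ i j → gen i ≈ gen j → i ≡ j)
                (z t : Fin n → Fin g) → ⟦ lagrangeₜ gen gen-injective z ⟧ (gen ∘ t) ≈ Δ z t
  ⟦lagrangeₜ⟧ {n} gen gen-injective z t =
    trans (⟦⟧-∏ (λ j → lagrange gen gen-injective (z j)) (gen ∘ t))
          (∏-cong n (λ j → lagrange-δ gen gen-injective (z j) (t j)))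

  -- Underdetermined homogeneous linear systems

  HomogeneousSolution : ∀ {r n} → (Fin r → Fin n → Carrier) → (Fin n → Carrier) → Set ℓ
  HomogeneousSolution {r} {n} A v = ∀ i → ∑ n (λ j → A i j * v j) ≈ 0#

  ∑[x+cy]v≈∑xv+c∑yv : ∀ n (X Y v : Fin n → Carrier) c →
          ∑ n (λ j → (X j + c * Y j) * v j) ≈ ∑ n (λ j → X j * v j) + c * ∑ n (λ j → Y j * v j)
  ∑[x+cy]v≈∑xv+c∑yv n X Y v c = begin
    ∑ n (λ j → (X j + c * Y j) * v j)
      ≈⟨ ∑-cong n (λ j → trans (distribʳ (v j) (X j) _) (+-cong refl (*-assoc c (Y j) (v j)))) ⟩
    ∑ n (λ j → X j * v j + c * (Y j * v j))
      ≈⟨ ∑-distrib-+ n _ _ ⟩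
    ∑ n (λ j → X j * v j) + ∑ n (λ j → c * (Y j * v j))
      ≈⟨ +-cong refl (*-distribˡ-∑ n c _) ⟨
    ∑ n (λ j → X j * v j) + c * ∑ n (λ j → Y j * v j) ∎

  module Elimination {r n} (A : Fin (suc r) → Fin (suc n) → Carrier)
                     (p : Fin (suc r)) (Aₚ₀≉0 : A p zero ≉ 0#) where

    a⁻¹ : Carrier
    a⁻¹ = proj₁ (inverse _ Aₚ₀≉0)

    multiplier : Fin r → Carrier
    multiplier i = - (A (punchIn p i) zero * a⁻¹)

    reduced : Fin r → Fin n → Carrier
    reduced i j = A (punchIn p i) (suc j) + multiplier i * A p (suc j)

    extend : (Fin n → Carrier) → Fin (suc n) → Carrier
    extend v = - (a⁻¹ * ∑ n (λ j → A p (suc j) * v j)) ∷ v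

    module _ (v : Fin n → Carrier) where

      private
        S : Carrier
        S = ∑ n (λ j → A p (suc j) * v j)

      x*-[a⁻¹*S]≈-[x*a⁻¹]*S : ∀ x → x * - (a⁻¹ * S) ≈ - (x * a⁻¹) * S
      x*-[a⁻¹*S]≈-[x*a⁻¹]*S x = begin
        x * - (a⁻¹ * S)    ≈⟨ -‿distribʳ-* x _ ⟨
        - (x * (a⁻¹ * S))  ≈⟨ -‿cong (*-assoc x a⁻¹ S) ⟨
        - ((x * a⁻¹) * S)  ≈⟨ -‿distribˡ-* _ S ⟩
        - (x * a⁻¹) * S    ∎

      pivot-row : ∑ (suc n) (λ j → A p j * extend v j) ≈ 0#
      pivot-row = begin
        A p zero * - (a⁻¹ * S) + S  ≈⟨ +-cong (x*-[a⁻¹*S]≈-[x*a⁻¹]*S (A p zero)) refl ⟩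
        - (A p zero * a⁻¹) * S + S  ≈⟨ +-cong (*-cong (-‿cong (proj₂ (inverse _ Aₚ₀≉0))) refl) refl ⟩
        - 1# * S + S                ≈⟨ +-cong (-‿distribˡ-* 1# S) refl ⟨
        - (1# * S) + S              ≈⟨ +-cong (-‿cong (*-identityˡ S)) refl ⟩
        - S + S                     ≈⟨ -‿inverseˡ S ⟩
        0#                          ∎

      other-row : HomogeneousSolution reduced v →
                  ∀ i → ∑ (suc n) (λ j → A (punchIn p i) j * extend v j) ≈ 0#
      other-row solves i = begin
        A (punchIn p i) zero * - (a⁻¹ * S) + ∑ n (λ j → A (punchIn p i) (suc j) * v j)
          ≈⟨ +-comm _ _ ⟩
        ∑ n (λ j → A (punchIn p i) (suc j) * v j) + A (punchIn p i) zero * - (a⁻¹ * S)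
          ≈⟨ +-cong refl (x*-[a⁻¹*S]≈-[x*a⁻¹]*S _) ⟩
        ∑ n (λ j → A (punchIn p i) (suc j) * v j) + multiplier i * S
          ≈⟨ ∑[x+cy]v≈∑xv+c∑yv n _ _ v (multiplier i) ⟨
        ∑ n (λ j → reduced i j * v j)
          ≈⟨ solves i ⟩
        0# ∎

      extend-solves : HomogeneousSolution reduced v → HomogeneousSolution A (extend v)
      extend-solves solves i with p ≟ i
      ... | yes ≡.refl = pivot-row
      ... | no  p≢i    = ≡.subst (λ i → ∑ (suc n) (λ j → A i j * extend v j) ≈ 0#)
                                 (Finₚ.punchIn-punchOut p≢i) (other-row solves (punchOut p≢i))

  unit₀ : ∀ {n} → Fin (suc n) → Carrier
  unit₀ = 1# ∷ λ _ → 0#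

  ∑-*unit₀ : ∀ n (a : Fin (suc n) → Carrier) → ∑ (suc n) (λ j → a j * unit₀ j) ≈ a zero
  ∑-*unit₀ n a = trans (+-cong (*-identityʳ _) (∑-zero n (λ _ → zeroʳ _))) (+-identityʳ _)

  underdetermined⇒nontrivial-solution :
    ∀ {r n} → r ℕ.< n → (A : Fin r → Fin n → Carrier) →
    ∃ λ v → HomogeneousSolution A v × ∃ λ j → v j ≉ 0#
  underdetermined⇒nontrivial-solution {zero}  {suc n} _ A = unit₀ , (λ ()) , zero , 1≉0
  underdetermined⇒nontrivial-solution {suc r} {suc n} (ℕ.s≤s r<n) A
    with Finₚ.all? (λ i → A i zero ≈? 0#)
  ... | yes column₀≈0 = unit₀ , (λ i → trans (∑-*unit₀ n (A i)) (column₀≈0 i)) , zero , 1≉0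
  ... | no  ¬column₀≈0
    with Finₚ.¬∀⟶∃¬ (suc r) _ (λ i → A i zero ≈? 0#) ¬column₀≈0
  ...   | p , Aₚ₀≉0 =
    let open Elimination A p Aₚ₀≉0
        v , solves , j , vⱼ≉0 = underdetermined⇒nontrivial-solution r<n reduced
    in extend v , extend-solves v solves , suc j , vⱼ≉0

  -- Moments of the weights

  moment : ∀ {m q} → ((Fin m → Carrier) → Carrier) → (Fin m → Fin q) → Carrier
  moment {m} coef e = sumFm F m (λ α → coef α * monomial α e)

  sumFm-⟦⟧ : ∀ {m q} (coef : (Fin m → Carrier) → Carrier) (p : (Fin m → Fin q) → Carrier) →
             sumFm F m (λ α → coef α * ⟦ p ⟧ α) ≈ ∑ₜ m q (λ e → p e * moment coef e)
  sumFm-⟦⟧ {m} {q} coef p = begin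
    ∑ₜ m size (λ σ → weight σ * ∑ₜ m q (λ e → p e * monomial (α σ) e))
      ≈⟨ ∑ₜ-cong m size (λ σ → *-distribˡ-∑ₜ m q (weight σ) _) ⟩
    ∑ₜ m size (λ σ → ∑ₜ m q (λ e → weight σ * (p e * monomial (α σ) e)))
      ≈⟨ ∑ₜ-cong m size (λ σ → ∑ₜ-cong m q (λ e → x∙yz≈y∙xz (weight σ) (p e) _)) ⟩
    ∑ₜ m size (λ σ → ∑ₜ m q (λ e → p e * (weight σ * monomial (α σ) e)))
      ≈⟨ ∑ₜ-comm m size m q _ ⟩
    ∑ₜ m q (λ e → ∑ₜ m size (λ σ → p e * (weight σ * monomial (α σ) e)))
      ≈⟨ ∑ₜ-cong m q (λ e → *-distribˡ-∑ₜ m size (p e) _) ⟨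
    ∑ₜ m q (λ e → p e * moment coef e) ∎
    where
    α : (Fin m → Fin size) → Fin m → Carrier
    α σ = enum ∘ σ
    weight : (Fin m → Fin size) → Carrier
    weight = coef ∘ α

  lhsSum-moments : ∀ {m k d d′} g (gen : Fin g → Carrier) coef (Z : Poly F m k d d′) →
                   lhsSum F g gen coef Z ≈
                   ∑ₜ m (suc d) (λ e → ∑ₜ k g (λ t → ⟦ Z e ⟧ (gen ∘ t)) * moment coef e)
  lhsSum-moments {m} {k} g gen coef Z =
    trans (∑ₜ-cong m size (λ σ → *-cong refl
            (trans (∑ₜ-cong k g (λ t → eval-iterated Z _ (gen ∘ t)))
                   (sym (⟦⟧-∑ₜ k g (λ t e → ⟦ Z e ⟧ (gen ∘ t)) _)))))
          (sumFm-⟦⟧ coef _)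

  nonzero-moment : ∀ {m k d d′} g (gen : Fin g → Carrier) coef (Z : Poly F m k d d′) →
                   lhsSum F g gen coef Z ≉ 0# → ∃ λ (e : Fin m → Fin (suc d)) → moment coef e ≉ 0#
  nonzero-moment {m} {k} {d} g gen coef Z lhs≉0 =
    let e , term≉0 = ∑ₜ-nonzero-term m (suc d) _ (lhs≉0 ∘ trans (lhsSum-moments g gen coef Z))
    in e , λ moment≈0 → term≉0 (trans (*-cong refl moment≈0) (zeroʳ _))

  _⊗_ : ∀ {m k d d′} → (Fin m → Fin (suc d)) → ((Fin k → Fin (suc d′)) → Carrier) → Poly F m k d d′
  (e ⊗ P) e′ E = Δ e e′ * P E

  eval-⊗ : ∀ {m k d d′} (e : Fin m → Fin (suc d)) (P : (Fin k → Fin (suc d′)) → Carrier) x y →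
           eval F (e ⊗ P) x y ≈ monomial x e * ⟦ P ⟧ y
  eval-⊗ e P x y = begin
    eval F (e ⊗ P) x y                        ≈⟨ eval-iterated (e ⊗ P) x y ⟩
    ⟦ (λ e′ → ⟦ (λ E → Δ e e′ * P E) ⟧ y) ⟧ x  ≈⟨ ⟦⟧-cong (λ e′ → ⟦⟧-*ˡ (Δ e e′) P y) x ⟩
    ⟦ (λ e′ → Δ e e′ * ⟦ P ⟧ y) ⟧ x            ≈⟨ ⟦⟧-*ʳ (Δ e) (⟦ P ⟧ y) x ⟩
    ⟦ Δ e ⟧ x * ⟦ P ⟧ y                        ≈⟨ *-cong (⟦Δ⟧ e x) refl ⟩
    monomial x e * ⟦ P ⟧ y                     ∎

  lhsSum-⊗ : ∀ {m k d d′} g (gen : Fin g → Carrier) coef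
             (e : Fin m → Fin (suc d)) (P : (Fin k → Fin (suc d′)) → Carrier) →
             lhsSum F g gen coef (e ⊗ P) ≈ moment coef e * ∑ₜ k g (λ t → ⟦ P ⟧ (gen ∘ t))
  lhsSum-⊗ {m} {k} g gen coef e P = begin
    ∑ₜ m size (λ σ → coef (α σ) * ∑ₜ k g (λ t → eval F (e ⊗ P) (α σ) (gen ∘ t)))
      ≈⟨ ∑ₜ-cong m size (λ σ → *-cong refl (∑ₜ-cong k g (λ t → eval-⊗ e P (α σ) (gen ∘ t)))) ⟩
    ∑ₜ m size (λ σ → coef (α σ) * ∑ₜ k g (λ t → monomial (α σ) e * ⟦ P ⟧ (gen ∘ t)))
      ≈⟨ ∑ₜ-cong m size (λ σ → *-cong refl (*-distribˡ-∑ₜ k g _ _)) ⟨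
    ∑ₜ m size (λ σ → coef (α σ) * (monomial (α σ) e * H))
      ≈⟨ ∑ₜ-cong m size (λ σ → *-assoc _ _ H) ⟨
    ∑ₜ m size (λ σ → (coef (α σ) * monomial (α σ) e) * H)
      ≈⟨ *-distribʳ-∑ₜ m size H _ ⟨
    moment coef e * H ∎
    where
    α : (Fin m → Fin size) → Fin m → Carrier
    α σ = enum ∘ σ
    H : Carrier
    H = ∑ₜ k g (λ t → ⟦ P ⟧ (gen ∘ t))

  rhsSum-⊗ : ∀ {m k d d′} s (pts : Fin s → (Fin m → Carrier) × (Fin k → Carrier)) dq
             (e : Fin m → Fin (suc d)) (P : (Fin k → Fin (suc d′)) → Carrier) →
             (∀ q → ⟦ P ⟧ (proj₂ (pts q)) ≈ 0#) → rhsSum F s pts dq (e ⊗ P) ≈ 0#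
  rhsSum-⊗ s pts dq e P P≈0 = ∑-zero s λ q →
    trans (*-cong refl (trans (eval-⊗ e P _ _) (trans (*-cong refl (P≈0 q)) (zeroʳ _))))
          (zeroʳ _)

  module _ {g} (gen : Fin g → Carrier) (gen-injective : ∀ i j → gen i ≈ gen j → i ≡ j)
           {m k d d′} (2[g∸1]≤d′ : 2 ℕ.* (g ℕ.∸ 1) ℕ.≤ d′)
           {s} (pts : Fin s → (Fin m → Carrier) × (Fin k → Carrier))
           (coef : (Fin m → Carrier) → Carrier) (dq : Fin s → Carrier)
           (exact : ∀ (Z : Poly F m k d d′) → lhsSum F g gen coef Z ≈ rhsSum F s pts dq Z) where

    open Convolution (exponent-sum-bound {g} {d′} 2[g∸1]≤d′)

    moment≉0⇒s≮gᵏ : ∀ (e : Fin m → Fin (suc d)) → moment coef e ≉ 0# → ¬ (s ℕ.< g ℕ.^ k)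
    moment≉0⇒s≮gᵏ e moment≉0 s<gᵏ = *-≉0 moment≉0 vᵢ₀≉0 (begin
      moment coef e * v i₀
        ≈⟨ *-cong refl pairing ⟨
      moment coef e * ∑ₜ k g (λ t → ⟦ u ⟧ (gen ∘ t) * ⟦ L i₀ ⟧ (gen ∘ t))
        ≈⟨ *-cong refl (∑ₜ-cong k g (λ t → ⟦⋆⟧ u (L i₀) (gen ∘ t))) ⟨
      moment coef e * ∑ₜ k g (λ t → ⟦ u ⋆ L i₀ ⟧ (gen ∘ t))
        ≈⟨ lhsSum-⊗ g gen coef e (u ⋆ L i₀) ⟨
      lhsSum F g gen coef (e ⊗ (u ⋆ L i₀))
        ≈⟨ exact (e ⊗ (u ⋆ L i₀)) ⟩
      rhsSum F s pts dq (e ⊗ (u ⋆ L i₀))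
        ≈⟨ rhsSum-⊗ s pts dq e (u ⋆ L i₀) (λ q →
             trans (⟦⋆⟧ u (L i₀) _) (trans (*-cong (u-vanishes q) refl) (zeroˡ _))) ⟩
      0# ∎)
      where
      N : ℕ
      N = g ℕ.^ k

      L : Fin N → (Fin k → Fin g) → Carrier
      L i = lagrangeₜ gen gen-injective (finToFun i)

      A : Fin s → Fin N → Carrier
      A q i = ⟦ L i ⟧ (proj₂ (pts q))

      solution : ∃ λ v → HomogeneousSolution A v × ∃ λ j → v j ≉ 0#
      solution = underdetermined⇒nontrivial-solution s<gᵏ A

      v : Fin N → Carrier
      v = proj₁ solution

      i₀ : Fin N
      i₀ = proj₁ (proj₂ (proj₂ solution))

      vᵢ₀≉0 : v i₀ ≉ 0#
      vᵢ₀≉0 = proj₂ (proj₂ (proj₂ solution))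

      u : (Fin k → Fin g) → Carrier
      u f = ∑ N (λ i → v i * L i f)

      ⟦u⟧ : ∀ y → ⟦ u ⟧ y ≈ ∑ N (λ i → v i * ⟦ L i ⟧ y)
      ⟦u⟧ y = trans (⟦⟧-∑ N (λ i f → v i * L i f) y) (∑-cong N (λ i → ⟦⟧-*ˡ (v i) (L i) y))

      u-vanishes : ∀ q → ⟦ u ⟧ (proj₂ (pts q)) ≈ 0#
      u-vanishes q = trans (⟦u⟧ _) (trans (∑-cong N (λ i → *-comm _ _)) (proj₁ (proj₂ solution) q))

      pairing : ∑ₜ k g (λ t → ⟦ u ⟧ (gen ∘ t) * ⟦ L i₀ ⟧ (gen ∘ t)) ≈ v i₀
      pairing = begin
        ∑ₜ k g (λ t → ⟦ u ⟧ (gen ∘ t) * ⟦ L i₀ ⟧ (gen ∘ t))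
          ≈⟨ ∑ₜ-cong k g (λ t → *-cong (trans (⟦u⟧ _) (∑-cong N (λ i → *-cong refl (⟦L⟧ i t))))
                                        (⟦L⟧ i₀ t)) ⟩
        ∑ₜ k g (λ t → ∑ N (λ i → v i * Δ (z i) t) * Δ (z i₀) t)
          ≈⟨ ∑ₜ-cong k g (λ t → trans (*-distribʳ-∑ N _ _) (∑-cong N (λ i → *-assoc _ _ _))) ⟩
        ∑ₜ k g (λ t → ∑ N (λ i → v i * (Δ (z i) t * Δ (z i₀) t)))
          ≈⟨ ∑ₜ-comm-∑ k g N _ ⟩
        ∑ N (λ i → ∑ₜ k g (λ t → v i * (Δ (z i) t * Δ (z i₀) t)))
          ≈⟨ ∑-cong N (λ i → trans (sym (*-distribˡ-∑ₜ k g (v i) _))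
                                   (*-comm (v i) _)) ⟩
        ∑ N (λ i → ∑ₜ k g (λ t → Δ (z i) t * Δ (z i₀) t) * v i)
          ≈⟨ ∑-cong N (λ i → *-cong (trans (∑ₜ-Δ*Δ k g (z i) (z i₀)) (Δ-finToFun {k} {g} i₀ i)) refl) ⟩
        ∑ N (λ i → δ i₀ i * v i)
          ≈⟨ ∑-δ N i₀ v ⟩
        v i₀ ∎
        where
        z : Fin N → Fin k → Fin g
        z = finToFun
        ⟦L⟧ : ∀ i t → ⟦ L i ⟧ (gen ∘ t) ≈ Δ (z i) t
        ⟦L⟧ i t = ⟦lagrangeₜ⟧ gen gen-injective (z i) t

corollary5p2 : ∀ {c ℓ : Level} (F : FiniteField c ℓ) →
    let open FiniteField F in
    (g : ℕ) (gen : Fin g → Carrier) → (∀ i j → gen i ≈ gen j → i ≡ j) →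
    (m k d d' : ℕ) → 2 ℕ.* (g ℕ.∸ 1) ℕ.≤ d' →
    (s : ℕ) (pts : Fin s → (Fin m → Carrier) × (Fin k → Carrier)) →
    (∀ i j → (∀ a → proj₁ (pts i) a ≈ proj₁ (pts j) a) →
             (∀ b → proj₂ (pts i) b ≈ proj₂ (pts j) b) → i ≡ j) →
    (coef : (Fin m → Carrier) → Carrier) (dq : Fin s → Carrier) →
    (∀ (Z : Poly F m k d d') → lhsSum F g gen coef Z ≈ rhsSum F s pts dq Z) →
    (∃ λ (Z′ : Poly F m k d d') → ¬ (lhsSum F g gen coef Z′ ≈ 0#)) →
    g ℕ.^ k ℕ.≤ s
corollary5p2 F g gen gen-injective m k d d′ 2[g∸1]≤d′ s pts _ coef dq exact (Z′ , lhs≉0) =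
  let e , moment≉0 = nonzero-moment F g gen coef Z′ lhs≉0
  in ℕₚ.≮⇒≥ (moment≉0⇒s≮gᵏ F gen gen-injective 2[g∸1]≤d′ pts coef dq exact e moment≉0)
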